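{- Let $G$ be a connected graph of order $n\ge 2$ with vertices $u_1,\dots,u_n$, and let $H_1,\dots,H_n$ be connected non-bipartite graphs, each $H_j$ with a chosen root vertex $v_j$. Then $$\dim_l(G\circ\mathcal{H})=\sum_{j=1}^n\bigl(\dim_l(H_j)-\alpha_j\bigr),$$ where $\alpha_j=1$ if the root $v_j$ belongs to some local metric basis of $H_j$, and $\alpha_j=0$ otherwise.
   Context: The rooted product graph $G\circ\mathcal{H}$, for $\mathcal{H}=(H_1,\dots,H_n)$, is obtained from disjoint copies of $G,H_1,\dots,H_n$ by identifying the root $v_i$ of $H_i$ with the $i$-th vertex $u_i$ of $G$, for each $i$. For a connected graph $G$, a set $W\subseteq V(G)$ is a local metric generator if for every pair of adjacent vertices $u,v$ there is $w\in W$ with $d_G(u,w)\neq d_G(v,w)$ ($d_G$ the shortest-path distance); $\dim_l(G)$ is the minimum cardinality of a local metric generator, and a local metric generator of this cardinality is a local metric basis. -}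

module Defs where

open import Data.Nat using (ℕ; zero; suc; _+_; _≤_)
open import Data.Fin using (Fin)
open import Data.Bool using (Bool)
open import Data.Product using (Σ; ∃; ∃-syntax; _×_; _,_)
open import Data.Sum using (_⊎_)
open import Data.List using (List; length)
open import Data.List.Membership.Propositional using (_∈_)
open import Data.List.Relation.Unary.Unique.Propositional using (Unique)
open import Relation.Nullary using (¬_)
open import Relation.Binary.PropositionalEquality using (_≡_; _≢_)
import Data.Fin as F

record Graph (V : Set) : Set₁ where
  field
    Adj    : V → V → Set
    sym    : ∀ {x y} → Adj x y → Adj y x
    irrefl : ∀ {x} → ¬ Adj x x
open Graph public

module _ {V : Set} (G : Graph V) where

  data Walk : V → V → ℕ → Set where
    nil  : ∀ {x} → Walk x x 0
    cons : ∀ {x y z k} → Adj G x y → Walk y z k → Walk x z (suc k)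

  Connected : Set
  Connected = ∀ x y → ∃[ k ] Walk x y k

  IsDist : V → V → ℕ → Set
  IsDist x y k = Walk x y k × (∀ k' → Walk x y k' → k ≤ k')

  Bipartite : Set
  Bipartite = Σ (V → Bool) λ c → ∀ x y → Adj G x y → c x ≢ c y

  Resolves : V → V → V → Set
  Resolves w x y = ∀ k₁ k₂ → IsDist x w k₁ → IsDist y w k₂ → k₁ ≢ k₂

  -- vertex sets are duplicate-free lists; cardinality = length
  IsLocalMetricGenerator : List V → Set
  IsLocalMetricGenerator W =
    Unique W × (∀ x y → Adj G x y → ∃[ w ] (w ∈ W × Resolves w x y))

  IsLocalMetricDim : ℕ → Set
  IsLocalMetricDim d =
    (∃[ W ] (IsLocalMetricGenerator W × length W ≡ d))
    × (∀ W → IsLocalMetricGenerator W → d ≤ length W)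

  IsLocalMetricBasis : List V → Set
  IsLocalMetricBasis W =
    IsLocalMetricGenerator W × (∀ W' → IsLocalMetricGenerator W' → length W ≤ length W')

-- Rooted product G ∘ H. Vertex (j , x) is vertex x of the copy of H_j;
-- the vertex (j , root j) is identified with u_j of G.
module _ {n : ℕ} {m : Fin n → ℕ} (G : Graph (Fin n))
         (H : (j : Fin n) → Graph (Fin (m j))) (root : (j : Fin n) → Fin (m j)) where

  data RAdj : Σ (Fin n) (λ j → Fin (m j)) → Σ (Fin n) (λ j → Fin (m j)) → Set where
    inH : ∀ {j x y} → Adj (H j) x y → RAdj (j , x) (j , y)
    inG : ∀ {i j} → Adj G i j → RAdj (i , root i) (j , root j)

  RAdj-sym : ∀ {p q} → RAdj p q → RAdj q p
  RAdj-sym (inH a) = inH (sym (H _) a)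
  RAdj-sym (inG a) = inG (sym G a)

  RAdj-irrefl : ∀ {p} → ¬ RAdj p p
  RAdj-irrefl (inH a) = irrefl (H _) a
  RAdj-irrefl (inG a) = irrefl G a

  rootedProduct : Graph (Σ (Fin n) (λ j → Fin (m j)))
  rootedProduct = record { Adj = RAdj ; sym = RAdj-sym ; irrefl = RAdj-irrefl }

∑ : ∀ {n} → (Fin n → ℕ) → ℕ
∑ {zero}  f = 0
∑ {suc n} f = f F.zero + ∑ (λ i → f (F.suc i))

module Submission where

open import Defs
open import Data.Nat using (ℕ; _≤_; _∸_)
open import Data.Fin using (Fin)
open import Data.Product using (Σ; ∃-syntax; _×_)
open import Data.Sum using (_⊎_)
open import Data.List.Membership.Propositional using (_∈_)
open import Relation.Nullary using (¬_)
open import Relation.Binary.PropositionalEquality using (_≡_)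

open import Data.Nat using (zero; suc; _+_; _<_; z≤n; s≤s; _≤?_)
open import Data.Nat.Properties
  using (≤-refl; ≤-trans; ≤-antisym; ≤-reflexive; ≰⇒>; +-mono-≤; +-suc; +-cancelʳ-≡;
         m+1+n≢m; m∸n≤m; ∸-mono; ∸-monoˡ-≤; m≤n⇒m≤1+n)
open import Data.Fin using (zero; suc; _≟_)
open import Data.Bool using (Bool; true; not)
open import Data.Bool.Properties using (not-injective)
open import Data.Product using (_,_; proj₁; proj₂)
open import Data.Sum using (inj₁; inj₂)
open import Data.Empty using (⊥-elim)
open import Function using (_∘_; id)
open import Data.List using (List; []; _∷_; length; map; concat; tabulate; filter)
open import Data.List.Properties
  using (length-++; length-map; filter-all; filter-accept; filter-reject)
open import Data.List.Membership.Propositional.Properties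
  using (∈-map⁺; ∈-map⁻; ∈-concat⁺′; ∈-tabulate⁺; ∈-filter⁺)
open import Data.List.Relation.Unary.Any using (here; there)
import Data.List.Membership.DecPropositional as DecMembership
open import Data.List.Relation.Unary.All using (All)
import Data.List.Relation.Unary.All as All
import Data.List.Relation.Unary.All.Properties as All
import Data.List.Relation.Unary.AllPairs.Properties as AllPairs
open import Data.List.Relation.Unary.AllPairs using ([]; _∷_)
open import Data.List.Relation.Unary.Unique.Propositional using (Unique)
import Data.List.Relation.Unary.Unique.Propositional.Properties as Unique
open import Data.List.Relation.Binary.Disjoint.Propositional using (Disjoint)
open import Relation.Nullary using (yes; no; ¬?)
open import Relation.Binary.Definitions using (DecidableEquality)
open import Relation.Binary.PropositionalEquality as ≡
  using (_≢_; refl; cong; cong₂; trans; subst; subst₂; ≢-sym)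
open ≡.≡-Reasoning

-- Write S ∪ {r} for "S together with the root r".  For a rooted graph (H, r)
-- with dim_l(H) = d, every duplicate-free S such that S ∪ {r} resolves all
-- edges has at least d - α elements, and one with exactly d - α exists (a basis,
-- minus r when α = 1).  In the rooted product, a landmark inside the copy of H_j
-- resolves an edge of that copy iff it does so in H_j, and a landmark outside
-- resolves it iff the root of H_j does, since those distances pass through the
-- root.  So the landmarks of any generator lying in copy j give such an S for
-- H_j (lower bound), and the union of the sets of size d_j - α_j is a generator
-- (upper bound): n ≥ 2 supplies a landmark in another copy, and d_j ≥ 2 (a single
-- landmark would 2-colour a non-bipartite graph by parity) makes each part
-- non-empty.  Distances exist only under double negation, which suffices since
-- resolving is a negative statement.

¬¬-finite-choice : ∀ {m} {P : Fin m → Set} → (∀ i → ¬ ¬ P i) → ¬ ¬ (∀ i → P i)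
¬¬-finite-choice {zero} _ no-choice = no-choice (λ ())
¬¬-finite-choice {suc m} {P} each no-choice =
  each zero λ p₀ →
    ¬¬-finite-choice {P = P ∘ suc} (each ∘ suc) λ rest →
      no-choice λ { zero → p₀ ; (suc i) → rest i }

¬¬-least : ∀ (P : ℕ → Set) {k} → P k → ¬ ¬ (∃[ m ] (P m × (∀ m′ → P m′ → m ≤ m′)))
¬¬-least P {k} pk no-least = none-below (suc k) k ≤-refl pk
  where
  none-below : ∀ b m → m < b → ¬ P m
  none-below (suc b) m (s≤s m≤b) pm = no-least (m , pm , least)
    where
    least : ∀ m′ → P m′ → m ≤ m′
    least m′ pm′ with m ≤? m′
    ... | yes m≤m′ = m≤m′
    ... | no m≰m′ = ⊥-elim (none-below b m′ (≤-trans (≰⇒> m≰m′) m≤b) pm′)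

module _ {V : Set} {G : Graph V} where

  _++ʷ_ : ∀ {x y z a b} → Walk G x y a → Walk G y z b → Walk G x z (a + b)
  nil ++ʷ q = q
  cons e p ++ʷ q = cons e (p ++ʷ q)

  snocʷ : ∀ {x y z k} → Walk G x y k → Adj G y z → Walk G x z (suc k)
  snocʷ nil e = cons e nil
  snocʷ (cons e′ p) e = cons e′ (snocʷ p e)

  reverseʷ : ∀ {x y k} → Walk G x y k → Walk G y x k
  reverseʷ nil = nil
  reverseʷ (cons e p) = snocʷ (reverseʷ p) (sym G e)

module _ {V : Set} (G : Graph V) where

  dist-unique : ∀ {x y a b} → IsDist G x y a → IsDist G x y b → a ≡ b
  dist-unique (p , p-min) (q , q-min) = ≤-antisym (p-min _ q) (q-min _ p)

  dist-sym : ∀ {x y k} → IsDist G x y k → IsDist G y x k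
  dist-sym (p , p-min) = reverseʷ p , λ k′ q → p-min k′ (reverseʷ q)

  dist-exists : ∀ {x y k} → Walk G x y k → ¬ ¬ (∃[ d ] IsDist G x y d)
  dist-exists p = ¬¬-least (Walk G _ _) p

  dist-adjacent : ∀ {x y} → Adj G x y → IsDist G x y 1
  dist-adjacent e = cons e nil , shortest
    where
    shortest : ∀ k → Walk G _ _ k → 1 ≤ k
    shortest zero nil = ⊥-elim (irrefl G e)
    shortest (suc k) _ = s≤s z≤n

  dist-step : ∀ {x y w a b} → IsDist G x w a → IsDist G y w b → Adj G x y → a ≤ suc b
  dist-step (_ , a-min) (q , _) e = a-min _ (cons e q)

parity : ℕ → Bool
parity zero = true
parity (suc k) = not (parity k)

parity-differs : ∀ a b → a ≤ suc b → b ≤ suc a → a ≢ b → parity a ≢ parity b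
parity-differs zero zero _ _ a≢b _ = a≢b refl
parity-differs zero (suc zero) _ _ _ ()
parity-differs zero (suc (suc b)) _ (s≤s ()) _
parity-differs (suc zero) zero _ _ _ ()
parity-differs (suc (suc a)) zero (s≤s ()) _ _
parity-differs (suc a) (suc b) (s≤s a≤b+1) (s≤s b≤a+1) a≢b =
  parity-differs a b a≤b+1 b≤a+1 (a≢b ∘ cong suc) ∘ not-injective

module _ {m : ℕ} (H : Graph (Fin m)) (connH : Connected H) (nonBip : ¬ Bipartite H) where

  -- if w resolved every edge, the parity of d(·, w) would 2-colour H
  single-landmark-fails : ∀ w → ¬ (∀ x y → Adj H x y → Resolves H w x y)
  single-landmark-fails w resolves =
    ¬¬-finite-choice (λ x → dist-exists H (proj₂ (connH x w))) λ dist →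
      nonBip ((λ x → parity (proj₁ (dist x))) , λ x y e →
        parity-differs _ _ (dist-step H (proj₂ (dist x)) (proj₂ (dist y)) e)
                           (dist-step H (proj₂ (dist y)) (proj₂ (dist x)) (sym H e))
                           (resolves x y e _ _ (proj₂ (dist x)) (proj₂ (dist y))))

  -- hence every local metric generator has two landmarks (with none, H would
  -- have no edges)
  generator-length≥2 : ∀ W → IsLocalMetricGenerator H W → 2 ≤ length W
  generator-length≥2 [] (_ , resolve) =
    ⊥-elim (nonBip ((λ _ → true) , λ x y e → ⊥-elim (no-landmark (resolve x y e))))
    where
    no-landmark : ∀ {P : Fin m → Set} → ¬ (∃[ w ] (w ∈ [] × P w))
    no-landmark (_ , () , _)
  generator-length≥2 (w ∷ []) (_ , resolve) = ⊥-elim (single-landmark-fails w only-w)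
    where
    only-w : ∀ x y → Adj H x y → Resolves H w x y
    only-w x y e with resolve x y e
    ... | (_ , here refl , res) = res
  generator-length≥2 (_ ∷ _ ∷ _) _ = s≤s (s≤s z≤n)

  dim≥2 : ∀ {d} → IsLocalMetricDim H d → 2 ≤ d
  dim≥2 ((W , genW , lenW) , _) = subst (2 ≤_) lenW (generator-length≥2 W genW)

module _ {V : Set} (H : Graph V) where

  basis-length : ∀ {d B} → IsLocalMetricDim H d → IsLocalMetricBasis H B → length B ≡ d
  basis-length {B = B} ((W , genW , lenW) , minimal) (genB , minB) =
    ≤-antisym (subst (length B ≤_) lenW (minB W genW)) (minimal _ genB)

  generator-of-dim-is-basis : ∀ {d W} → IsLocalMetricDim H d →
                              IsLocalMetricGenerator H W → length W ≡ d → IsLocalMetricBasis H W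
  generator-of-dim-is-basis (_ , minimal) genW lenW =
    genW , λ W′ genW′ → subst (_≤ length W′) (≡.sym lenW) (minimal W′ genW′)

length-delete : ∀ {A : Set} (_≟ₐ_ : DecidableEquality A) {r : A} {xs} → Unique xs → r ∈ xs →
                suc (length (filter (λ x → ¬? (x ≟ₐ r)) xs)) ≡ length xs
length-delete _≟ₐ_ {r} {.r ∷ xs} (r∉xs ∷ _) (here refl) = begin
  suc (length (filter r̸? (r ∷ xs))) ≡⟨ cong (suc ∘ length) (filter-reject r̸? (λ r≢r → r≢r refl)) ⟩
  suc (length (filter r̸? xs))       ≡⟨ cong (suc ∘ length) (filter-all r̸? (All.map ≢-sym r∉xs)) ⟩
  suc (length xs)                    ∎
  where r̸? = λ x → ¬? (x ≟ₐ r)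
length-delete _≟ₐ_ {r} {x ∷ xs} (x∉xs ∷ uxs) (there r∈xs) =
  trans (cong (suc ∘ length) (filter-accept r̸? (All.lookup x∉xs r∈xs)))
        (cong suc (length-delete _≟ₐ_ uxs r∈xs))
  where r̸? = λ x → ¬? (x ≟ₐ r)

module _ {m : ℕ} (H : Graph (Fin m)) (r : Fin m) where

  RootInBasis : Set
  RootInBasis = ∃[ W ] (IsLocalMetricBasis H W × r ∈ W)

  RootCorrection : ℕ → Set
  RootCorrection α = (α ≡ 1 × RootInBasis) ⊎ (α ≡ 0 × ¬ RootInBasis)

  root-correction≤1 : ∀ {α} → RootCorrection α → α ≤ 1
  root-correction≤1 (inj₁ (refl , _)) = ≤-refl
  root-correction≤1 (inj₂ (refl , _)) = z≤n

  GeneratesWithRoot : List (Fin m) → Set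
  GeneratesWithRoot S =
    ∀ x y → Adj H x y → (∃[ w ] (w ∈ S × Resolves H w x y)) ⊎ Resolves H r x y

  generator-from : ∀ {S S′} → Unique S′ → (∀ {w} → w ∈ S → w ∈ S′) → r ∈ S′ →
                   GeneratesWithRoot S → IsLocalMetricGenerator H S′
  generator-from uS′ S⊆S′ r∈S′ gen = uS′ , resolve
    where
    resolve : ∀ x y → Adj H x y → ∃[ w ] (w ∈ _ × Resolves H w x y)
    resolve x y e with gen x y e
    ... | inj₁ (w , w∈S , res) = w , S⊆S′ w∈S , res
    ... | inj₂ res = r , r∈S′ , res

  generator-or-extension : ∀ {S} → Unique S → GeneratesWithRoot S →
                           IsLocalMetricGenerator H S ⊎ IsLocalMetricGenerator H (r ∷ S)
  generator-or-extension {S} uS gen with DecMembership._∈?_ _≟_ r S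
  ... | yes r∈S = inj₁ (generator-from uS id r∈S gen)
  ... | no r∉S = inj₂ (generator-from (r∉S′ ∷ uS) there (here refl) gen)
    where
    r∉S′ : All (r ≢_) S
    r∉S′ = All.tabulate λ w∈S r≡w → r∉S (subst (_∈ S) (≡.sym r≡w) w∈S)

  -- if r ∷ S generates, then |S| ≥ d - α; equality with α = 0 would make r ∷ S
  -- a basis containing the root
  extension-bound : ∀ {d α S} → IsLocalMetricDim H d → RootCorrection α →
                    IsLocalMetricGenerator H (r ∷ S) → d ∸ α ≤ length S
  extension-bound dim (inj₁ (refl , _)) gen = ∸-monoˡ-≤ 1 (proj₂ dim _ gen)
  extension-bound {d} {S = S} dim (inj₂ (refl , notInBasis)) gen with d ≤? length S
  ... | yes d≤|S| = d≤|S|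
  ... | no d≰|S| =
    ⊥-elim (notInBasis (r ∷ S , generator-of-dim-is-basis H dim gen (≡.sym d≡) , here refl))
    where
    d≡ : d ≡ suc (length S)
    d≡ = ≤-antisym (proj₂ dim _ gen) (≰⇒> d≰|S|)

  root-free-lower-bound : ∀ {d α S} → IsLocalMetricDim H d → RootCorrection α →
                          Unique S → GeneratesWithRoot S → d ∸ α ≤ length S
  root-free-lower-bound {d} {α} dim corr uS gen with generator-or-extension uS gen
  ... | inj₁ genS = ≤-trans (m∸n≤m d α) (proj₂ dim _ genS)
  ... | inj₂ genS⁺ = extension-bound dim corr genS⁺

  -- a generator up to the root of size d - α: a basis, minus the root if α = 1
  root-free-generator : ∀ {d α} → IsLocalMetricDim H d → RootCorrection α →
                        ∃[ L ] (Unique L × length L ≡ d ∸ α × GeneratesWithRoot L)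
  root-free-generator ((W , (uW , resolveW) , lenW) , _) (inj₂ (refl , _)) =
    W , uW , lenW , λ x y e → inj₁ (resolveW x y e)
  root-free-generator {d} dim (inj₁ (refl , B , basis@((uB , resolveB) , _) , r∈B)) =
    L , Unique.filter⁺ r̸? uB , length-L , generates
    where
    r̸? = λ w → ¬? (w ≟ r)
    L = filter r̸? B
    length-L : length L ≡ d ∸ 1
    length-L = cong (_∸ 1) (trans (length-delete _≟_ uB r∈B) (basis-length H dim basis))
    generates : GeneratesWithRoot L
    generates x y e with resolveB x y e
    ... | (w , w∈B , res) with w ≟ r
    ...   | yes refl = inj₂ res
    ...   | no w≢r = inj₁ (w , ∈-filter⁺ r̸? w∈B w≢r , res)

∑-cong : ∀ {n} {f g : Fin n → ℕ} → (∀ j → f j ≡ g j) → ∑ f ≡ ∑ g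
∑-cong {zero} _ = refl
∑-cong {suc n} f≡g = cong₂ _+_ (f≡g zero) (∑-cong (f≡g ∘ suc))

∑-mono : ∀ {n} {f g : Fin n → ℕ} → (∀ j → f j ≤ g j) → ∑ f ≤ ∑ g
∑-mono {zero} _ = z≤n
∑-mono {suc n} f≤g = +-mono-≤ (f≤g zero) (∑-mono (f≤g ∘ suc))

∑-zero : ∀ n → ∑ {n} (λ _ → 0) ≡ 0
∑-zero zero = refl
∑-zero (suc n) = ∑-zero n

∑-suc-at : ∀ {n} (i : Fin n) {f g : Fin n → ℕ} →
           g i ≡ suc (f i) → (∀ j → j ≢ i → g j ≡ f j) → ∑ g ≡ suc (∑ f)
∑-suc-at zero gᵢ others = cong₂ _+_ gᵢ (∑-cong λ j → others (suc j) λ ())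
∑-suc-at (suc i) {f} gᵢ others =
  trans (cong₂ _+_ (others zero λ ())
                   (∑-suc-at i gᵢ λ j j≢i → others (suc j) λ { refl → j≢i refl }))
        (+-suc (f zero) _)

length-concat-tabulate : ∀ {A : Set} {n} (xs : Fin n → List A) →
                         length (concat (tabulate xs)) ≡ ∑ (length ∘ xs)
length-concat-tabulate {n = zero} _ = refl
length-concat-tabulate {n = suc n} xs =
  trans (length-++ (xs zero)) (cong (length (xs zero) +_) (length-concat-tabulate (xs ∘ suc)))

tag : ∀ {n} {A : Fin n → Set} (j : Fin n) → A j → Σ (Fin n) A
tag j x = j , x

⋃ : ∀ {n} {A : Fin n → Set} → ((j : Fin n) → List (A j)) → List (Σ (Fin n) A)
⋃ L = concat (tabulate λ j → map (tag j) (L j))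

module _ {n : ℕ} {A : Fin n → Set} (L : (j : Fin n) → List (A j)) where

  length-⋃ : length (⋃ L) ≡ ∑ (λ j → length (L j))
  length-⋃ = trans (length-concat-tabulate (λ j → map (tag j) (L j)))
                   (∑-cong λ j → length-map (tag {A = A} j) (L j))

  ∈-⋃ : ∀ {j x} → x ∈ L j → (j , x) ∈ ⋃ L
  ∈-⋃ {j} x∈ = ∈-concat⁺′ (∈-map⁺ (tag j) x∈) (∈-tabulate⁺ {f = λ i → map (tag i) (L i)} j)

  ⋃-unique : (∀ j → Unique (L j)) → Unique (⋃ L)
  ⋃-unique u = Unique.concat⁺ (All.tabulate⁺ λ j → Unique.map⁺ (tag-injective {j}) (u j))
                              (AllPairs.tabulate⁺ disjoint)
    where
    tag-injective : ∀ {j} {x y : A j} → tag j x ≡ tag j y → x ≡ y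
    tag-injective refl = refl
    disjoint : ∀ {i j} → i ≢ j → Disjoint (map (tag i) (L i)) (map (tag j) (L j))
    disjoint i≢j (p , q) with ∈-map⁻ _ p | ∈-map⁻ _ q
    ... | (_ , _ , refl) | (_ , _ , eq) = i≢j (cong proj₁ eq)

nonempty-member : ∀ {A : Set} (xs : List A) → 1 ≤ length xs → ∃[ x ] (x ∈ xs)
nonempty-member (x ∷ _) _ = x , here refl

another : ∀ {n} → 2 ≤ n → (j : Fin n) → ∃[ i ] (i ≢ j)
another (s≤s (s≤s _)) zero = suc zero , λ ()
another (s≤s (s≤s _)) (suc _) = zero , λ ()

module RootedProduct {n : ℕ} {m : Fin n → ℕ} (G : Graph (Fin n))
                     (H : (j : Fin n) → Graph (Fin (m j))) (root : (j : Fin n) → Fin (m j))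
                     (connG : Connected G) (connH : ∀ j → Connected (H j)) where

  V : Set
  V = Σ (Fin n) (λ j → Fin (m j))

  G∘H : Graph V
  G∘H = rootedProduct G H root

  embed-copy : ∀ {j x y k} → Walk (H j) x y k → Walk G∘H (j , x) (j , y) k
  embed-copy nil = nil
  embed-copy (cons e p) = cons (inH e) (embed-copy p)

  embed-base : ∀ {i i′ k} → Walk G i i′ k → Walk G∘H (i , root i) (i′ , root i′) k
  embed-base nil = nil
  embed-base (cons e p) = cons (inG e) (embed-base p)

  connected : Connected G∘H
  connected (j , x) (i , y) =
    let (_ , p) = connH j x (root j)
        (_ , q) = connG j i
        (_ , s) = connH i (root i) y
    in _ , embed-copy p ++ʷ (embed-base q ++ʷ embed-copy s)

  project : (j : Fin n) → V → Fin (m j)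
  project j (i , x) with i ≟ j
  ... | yes refl = x
  ... | no _ = root j

  project-self : ∀ j x → project j (j , x) ≡ x
  project-self j x with j ≟ j
  ... | yes refl = refl
  ... | no j≢j = ⊥-elim (j≢j refl)

  project-root : ∀ j i → project j (i , root i) ≡ root j
  project-root j i with i ≟ j
  ... | yes refl = refl
  ... | no _ = refl

  project-edge : ∀ j {p q} → Adj G∘H p q →
                 Adj (H j) (project j p) (project j q) ⊎ project j p ≡ project j q
  project-edge j (inH {i} e) with i ≟ j
  ... | yes refl = inj₁ e
  ... | no _ = inj₂ refl
  project-edge j (inG {i} {i′} _) = inj₂ (trans (project-root j i) (≡.sym (project-root j i′)))

  project-walk : ∀ j {p q k} → Walk G∘H p q k →
                 ∃[ k′ ] (k′ ≤ k × Walk (H j) (project j p) (project j q) k′)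
  project-walk j nil = 0 , z≤n , nil
  project-walk j (cons e p) with project-walk j p | project-edge j e
  ... | (k′ , k′≤k , p′) | inj₁ e′ = suc k′ , s≤s k′≤k , cons e′ p′
  ... | (k′ , k′≤k , p′) | inj₂ same =
    k′ , m≤n⇒m≤1+n k′≤k , subst (λ z → Walk (H j) z _ k′) (≡.sym same) p′

  walk-in-copy : ∀ {j x y k} → Walk G∘H (j , x) (j , y) k → ∃[ k′ ] (k′ ≤ k × Walk (H j) x y k′)
  walk-in-copy {j} {x} {y} p =
    let (k′ , k′≤k , p′) = project-walk j p
    in k′ , k′≤k , subst₂ (λ a b → Walk (H j) a b k′) (project-self j x) (project-self j y) p′

  dist-in-copy⁺ : ∀ {j x y k} → IsDist (H j) x y k → IsDist G∘H (j , x) (j , y) k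
  dist-in-copy⁺ (p , p-min) = embed-copy p , λ k′ q →
    let (k″ , k″≤k′ , q′) = walk-in-copy q in ≤-trans (p-min k″ q′) k″≤k′

  dist-in-copy⁻ : ∀ {j x y k} → IsDist G∘H (j , x) (j , y) k → IsDist (H j) x y k
  dist-in-copy⁻ (p , p-min) with walk-in-copy p
  ... | (k′ , k′≤k , p′) with ≤-antisym k′≤k (p-min k′ (embed-copy p′))
  ...   | refl = p′ , λ k″ q → p-min k″ (embed-copy q)

  exit-through-root : ∀ {j x w K} → Walk G∘H (j , x) w K → proj₁ w ≢ j →
    ∃[ a ] ∃[ b ] (a + b ≡ K × Walk G∘H (j , x) (j , root j) a × Walk G∘H (j , root j) w b)
  exit-through-root nil w∉j = ⊥-elim (w∉j refl)
  exit-through-root (cons (inH e) rest) w∉j =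
    let (a , b , a+b≡K , p , q) = exit-through-root rest w∉j
    in suc a , b , cong suc a+b≡K , cons (inH e) p , q
  exit-through-root (cons (inG e) rest) _ = 0 , _ , refl , nil , cons (inG e) rest

  dist-via-root : ∀ {j x w k D} → IsDist (H j) x (root j) k → IsDist G∘H (j , root j) w D →
                  proj₁ w ≢ j → IsDist G∘H (j , x) w (k + D)
  dist-via-root {j} {x} {w} {k} {D} (p , p-min) (q , q-min) w∉j = embed-copy p ++ʷ q , shortest
    where
    shortest : ∀ K → Walk G∘H (j , x) w K → k + D ≤ K
    shortest K r with exit-through-root r w∉j
    ... | (a , b , refl , r₁ , r₂) =
      let (a′ , a′≤a , r₁′) = walk-in-copy r₁
      in +-mono-≤ (≤-trans (p-min a′ r₁′) a′≤a) (q-min b r₂)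

  resolves-in-copy⁺ : ∀ {j w x y} → Resolves (H j) w x y → Resolves G∘H (j , w) (j , x) (j , y)
  resolves-in-copy⁺ res k₁ k₂ d₁ d₂ = res k₁ k₂ (dist-in-copy⁻ d₁) (dist-in-copy⁻ d₂)

  resolves-in-copy⁻ : ∀ {j w x y} → Resolves G∘H (j , w) (j , x) (j , y) → Resolves (H j) w x y
  resolves-in-copy⁻ res k₁ k₂ d₁ d₂ = res k₁ k₂ (dist-in-copy⁺ d₁) (dist-in-copy⁺ d₂)

  resolves-outside⁺ : ∀ {j w x y} → Resolves (H j) (root j) x y → proj₁ w ≢ j →
                      Resolves G∘H w (j , x) (j , y)
  resolves-outside⁺ {j} {w} {x} {y} res w∉j K₁ K₂ d₁ d₂ K₁≡K₂ =
    dist-exists G∘H (proj₂ (connected (j , root j) w)) λ (D , dD) →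
    dist-exists (H j) (proj₂ (connH j x (root j))) λ (k₁ , e₁) →
    dist-exists (H j) (proj₂ (connH j y (root j))) λ (k₂ , e₂) →
      res k₁ k₂ e₁ e₂ (+-cancelʳ-≡ D k₁ k₂ (begin
        k₁ + D ≡⟨ dist-unique G∘H (dist-via-root e₁ dD w∉j) d₁ ⟩
        K₁     ≡⟨ K₁≡K₂ ⟩
        K₂     ≡⟨ dist-unique G∘H d₂ (dist-via-root e₂ dD w∉j) ⟩
        k₂ + D ∎))

  resolves-outside⁻ : ∀ {j w x y} → Resolves G∘H w (j , x) (j , y) → proj₁ w ≢ j →
                      Resolves (H j) (root j) x y
  resolves-outside⁻ {j} {w} res w∉j k₁ k₂ e₁ e₂ k₁≡k₂ =
    dist-exists G∘H (proj₂ (connected (j , root j) w)) λ (D , dD) →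
      res (k₁ + D) (k₂ + D) (dist-via-root e₁ dD w∉j) (dist-via-root e₂ dD w∉j) (cong (_+ D) k₁≡k₂)

  -- an edge of G between roots is resolved by every vertex of the first copy,
  -- whose distances to the two roots are k and k + 1
  resolves-base-edge : ∀ {i i′} → Adj G i i′ → (z : Fin (m i)) →
                       Resolves G∘H (i , z) (i , root i) (i′ , root i′)
  resolves-base-edge {i} {i′} e z K₁ K₂ d₁ d₂ K₁≡K₂ =
    dist-exists (H i) (proj₂ (connH i z (root i))) λ (k , dz) →
      m+1+n≢m k (begin
        k + 1 ≡⟨ dist-unique G∘H (dist-via-root dz (dist-adjacent G∘H (inG e)) i′≢i)
                                 (dist-sym G∘H d₂) ⟩
        K₂    ≡⟨ ≡.sym K₁≡K₂ ⟩
        K₁    ≡⟨ dist-unique G∘H d₁ (dist-in-copy⁺ (dist-sym (H i) dz)) ⟩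
        k     ∎)
    where
    i′≢i : i′ ≢ i
    i′≢i refl = irrefl G e

  restrict : (j : Fin n) → List V → List (Fin (m j))
  restrict j [] = []
  restrict j ((i , x) ∷ W) with i ≟ j
  ... | yes refl = x ∷ restrict j W
  ... | no _ = restrict j W

  restrict-here : ∀ i x W → restrict i ((i , x) ∷ W) ≡ x ∷ restrict i W
  restrict-here i x W with i ≟ i
  ... | yes refl = refl
  ... | no i≢i = ⊥-elim (i≢i refl)

  restrict-there : ∀ {i j} x W → i ≢ j → restrict j ((i , x) ∷ W) ≡ restrict j W
  restrict-there {i} {j} x W i≢j with i ≟ j
  ... | yes refl = ⊥-elim (i≢j refl)
  ... | no _ = refl

  ∈-restrict⁺ : ∀ {j x W} → (j , x) ∈ W → x ∈ restrict j W
  ∈-restrict⁺ {j} {x} {.(j , x) ∷ W} (here refl) =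
    subst (x ∈_) (≡.sym (restrict-here j x W)) (here refl)
  ∈-restrict⁺ {j} {W = (i , y) ∷ W} (there p) with i ≟ j
  ... | yes refl = there (∈-restrict⁺ p)
  ... | no _ = ∈-restrict⁺ p

  ∈-restrict⁻ : ∀ {j x W} → x ∈ restrict j W → (j , x) ∈ W
  ∈-restrict⁻ {j} {W = (i , y) ∷ W} p with i ≟ j
  ∈-restrict⁻ (here refl) | yes refl = here refl
  ∈-restrict⁻ (there p) | yes refl = there (∈-restrict⁻ p)
  ∈-restrict⁻ p | no _ = there (∈-restrict⁻ p)

  restrict-unique : ∀ {j W} → Unique W → Unique (restrict j W)
  restrict-unique {j} {[]} [] = []
  restrict-unique {j} {(i , x) ∷ W} (x∉W ∷ uW) with i ≟ j
  ... | yes refl = All.tabulate (λ y∈ x≡y → All.lookup x∉W (∈-restrict⁻ y∈) (cong (j ,_) x≡y))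
                   ∷ restrict-unique uW
  ... | no _ = restrict-unique uW

  -- every landmark lies in exactly one copy
  length-restrict : ∀ W → length W ≡ ∑ (λ j → length (restrict j W))
  length-restrict [] = ≡.sym (∑-zero n)
  length-restrict ((i , x) ∷ W) =
    trans (cong suc (length-restrict W))
          (≡.sym (∑-suc-at i (cong length (restrict-here i x W))
                             (λ j j≢i → cong length (restrict-there x W (≢-sym j≢i)))))

  restriction-generates : ∀ {W} → IsLocalMetricGenerator G∘H W → ∀ j →
                          GeneratesWithRoot (H j) (root j) (restrict j W)
  restriction-generates (_ , resolve) j x y e with resolve (j , x) (j , y) (inH e)
  ... | ((i , w) , w∈W , res) with i ≟ j
  ...   | yes refl = inj₁ (w , ∈-restrict⁺ w∈W , resolves-in-copy⁻ res)
  ...   | no i≢j = inj₂ (resolves-outside⁻ res i≢j)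

  union-generates : (L : (j : Fin n) → List (Fin (m j))) → (∀ j → Unique (L j)) →
                    (∀ j → ∃[ x ] (x ∈ L j)) → (∀ j → GeneratesWithRoot (H j) (root j) (L j)) →
                    (∀ j → ∃[ i ] (i ≢ j)) → IsLocalMetricGenerator G∘H (⋃ L)
  union-generates L uL nonempty gen another-copy = ⋃-unique L uL , resolve
    where
    resolve : ∀ p q → Adj G∘H p q → ∃[ w ] (w ∈ ⋃ L × Resolves G∘H w p q)
    resolve _ _ (inH {j} {x} {y} e) with gen j x y e
    ... | inj₁ (w , w∈L , res) = (j , w) , ∈-⋃ L w∈L , resolves-in-copy⁺ res
    ... | inj₂ res =
      let (i , i≢j) = another-copy j
          (z , z∈L) = nonempty i
      in (i , z) , ∈-⋃ L z∈L , resolves-outside⁺ res i≢j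
    resolve _ _ (inG {i} e) =
      let (z , z∈L) = nonempty i in (i , z) , ∈-⋃ L z∈L , resolves-base-edge e z

  module Dimension {d α : Fin n → ℕ} (dim : ∀ j → IsLocalMetricDim (H j) (d j))
                   (corr : ∀ j → RootCorrection (H j) (root j) (α j)) where

    lower-bound : ∀ W → IsLocalMetricGenerator G∘H W → ∑ (λ j → d j ∸ α j) ≤ length W
    lower-bound W genW@(uW , _) =
      ≤-trans (∑-mono λ j → root-free-lower-bound (H j) (root j) (dim j) (corr j)
                              (restrict-unique uW) (restriction-generates genW j))
              (≤-reflexive (≡.sym (length-restrict W)))

    upper-bound : 2 ≤ n → (∀ j → ¬ Bipartite (H j)) →
                  ∃[ W ] (IsLocalMetricGenerator G∘H W × length W ≡ ∑ (λ j → d j ∸ α j))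
    upper-bound 2≤n nonBip =
      ⋃ L , union-generates L uL nonempty genL (another 2≤n) , trans (length-⋃ L) (∑-cong lenL)
      where
      part : ∀ j → ∃[ L ] (Unique L × length L ≡ d j ∸ α j × GeneratesWithRoot (H j) (root j) L)
      part j = root-free-generator (H j) (root j) (dim j) (corr j)
      L : (j : Fin n) → List (Fin (m j))
      L j = proj₁ (part j)
      uL : ∀ j → Unique (L j)
      uL j = proj₁ (proj₂ (part j))
      lenL : ∀ j → length (L j) ≡ d j ∸ α j
      lenL j = proj₁ (proj₂ (proj₂ (part j)))
      genL : ∀ j → GeneratesWithRoot (H j) (root j) (L j)
      genL j = proj₂ (proj₂ (proj₂ (part j)))
      -- |L_j| = d_j - α_j ≥ 2 - 1
      nonempty : ∀ j → ∃[ x ] (x ∈ L j)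
      nonempty j = nonempty-member (L j) (subst (1 ≤_) (≡.sym (lenL j))
        (∸-mono (dim≥2 (H j) (connH j) (nonBip j) (dim j))
                (root-correction≤1 (H j) (root j) (corr j))))

corollary8 : (n : ℕ) → 2 ≤ n → (G : Graph (Fin n)) → Connected G →
  (m : Fin n → ℕ) → (H : (j : Fin n) → Graph (Fin (m j))) →
  (root : (j : Fin n) → Fin (m j)) →
  (∀ j → Connected (H j)) → (∀ j → ¬ Bipartite (H j)) →
  (d : Fin n → ℕ) → (∀ j → IsLocalMetricDim (H j) (d j)) →
  (α : Fin n → ℕ) →
  (∀ j → (α j ≡ 1 × (∃[ W ] (IsLocalMetricBasis (H j) W × root j ∈ W)))
       ⊎ (α j ≡ 0 × ¬ (∃[ W ] (IsLocalMetricBasis (H j) W × root j ∈ W)))) →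
  IsLocalMetricDim (rootedProduct G H root) (∑ (λ j → d j ∸ α j))
corollary8 n 2≤n G connG m H root connH nonBip d dim α corr =
  upper-bound 2≤n nonBip , lower-bound
  where open RootedProduct G H root connG connH
        open Dimension dim corr
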